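{- Let $S$ be a facet of $\mathcal{T}_{\mathbf{a}}$ and let $1\le i\le n$. Then exactly one of the following holds: (A) there is a unique $j\in[a_i]$ with $S\cap V(e^{(i)}_j)=\{\overrightarrow{y}^{(i)}_j,z^{(i)}_j\}$, and for every $k\in[a_i]\setminus\{j\}$ we have $|S\cap V(e^{(i)}_k)|=1$ with $S\cap V(e^{(i)}_k)\subseteq\{t^{(i)}_k,z^{(i)}_k\}$ if $k<j$ and $S\cap V(e^{(i)}_k)\subseteq\{t^{(i)}_k,\overrightarrow{y}^{(i)}_k\}$ if $k>j$; (B) there is a unique $j\in[a_i]$ with $S\cap V(e^{(i)}_j)=\{\overleftarrow{y}^{(i)}_j,z^{(i)}_j\}$, and for every $k\in[a_i]\setminus\{j\}$ we have $|S\cap V(e^{(i)}_k)|=1$ with $S\cap V(e^{(i)}_k)\subseteq\{t^{(i)}_k,\overleftarrow{y}^{(i)}_k\}$ if $k<j$ and $S\cap V(e^{(i)}_k)\subseteq\{t^{(i)}_k,z^{(i)}_k\}$ if $k>j$; (C) $|S\cap V(e^{(i)}_j)|=1$ for all $j\in[a_i]$.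
   Context: Fix $n\ge3$ and $\mathbf{a}=(a_1,\ldots,a_n)$ with $a_i\ge1$. $C_{\mathbf{a}}$ is the graph on $[n]$ (indices mod $n$) whose edges are, for each $i$, the $a_i$ parallel edges $e^{(i)}_1,\ldots,e^{(i)}_{a_i}$ between $i$ and $i+1$ (the $i$-th multi-edge); $E$ denotes its edge set. Direction $i\to i+1$ is called clockwise. Let $R_{\mathbf{a}}$ be the polynomial ring over a field $K$ in variables $z_k$ ($k\in[n]$), and for each edge $e=e^{(i)}_j$: $z^{(i)}_j$, $t^{(i)}_j$, $\overrightarrow{y}^{(i)}_j$, $\overleftarrow{y}^{(i)}_j$, corresponding respectively to the lattice points $\mathbf{e}_k$, $\mathbf{e}_e$, $\mathbf{e}_i+\mathbf{e}_{i+1}-\mathbf{e}_e$, $\mathbf{e}_i-\mathbf{e}_{i+1}+\mathbf{e}_e$, $-\mathbf{e}_i+\mathbf{e}_{i+1}+\mathbf{e}_e$ of $\mathbb{R}^{[n]\cup E}$ (these are all lattice points of the cosmological polytope $\mathcal{C}_{C_{\mathbf{a}}}=\mathrm{conv}$ of the last three types). Put $V(e^{(i)}_j)=\{\overrightarrow{y}^{(i)}_j,\overleftarrow{y}^{(i)}_j,t^{(i)}_j,z^{(i)}_j\}$. Order the variables: $\overrightarrow{y}^{(1)}_1>\cdots>\overrightarrow{y}^{(1)}_{a_1}>\overrightarrow{y}^{(2)}_1>\cdots>\overrightarrow{y}^{(n)}_{a_n}>\overleftarrow{y}^{(n)}_{a_n}>\overleftarrow{y}^{(n)}_{a_n-1}>\cdots>\overleftarrow{y}^{(n)}_1>\overleftarrow{y}^{(n-1)}_{a_{n-1}}>\cdots>\overleftarrow{y}^{(1)}_1>z^{(1)}_1>\cdots>z^{(1)}_{a_1}>z^{(2)}_1>\cdots>z^{(n)}_{a_n}>t^{(1)}_1>\cdots>t^{(n)}_{a_n}>z_1>\cdots>z_n$,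 and let $<$ be the induced lexicographic term order. For an edge $e$ with endpoints $a,b$ directed $a\to b$, write $y(a\to b)$ for the corresponding $y$-variable (e.g. $y(i\to i+1)=\overrightarrow{y}^{(i)}_j$ for $e=e^{(i)}_j$). Let $B$ be the set of binomials: (fundamental) for each edge $e$ with endpoints $i,i+1$: $\overrightarrow{y}\,\overleftarrow{y}-z_e^2$, $\overrightarrow{y}\,t-z_i^2$, $\overleftarrow{y}\,t-z_{i+1}^2$, $\overrightarrow{y}z_{i+1}-z_iz_e$, $\overleftarrow{y}z_i-z_{i+1}z_e$, $tz_e-z_iz_{i+1}$ (with variables of $e$); (zig-zag) for each path $P$ from $u$ to $v$ of length $\ge2$ and partition $E(P)=P_1\cup P_2$ with the edge at $u$ in $P_1$ and the edge at $v$ in $P_2$, with $E_1$ = edges of $P_1$ directed towards $v$, $E_2$ = edges of $P_2$ directed towards $u$: $z_v\prod_{f\in E_1}y(f)\prod_{f\in E_2}z_f-z_u\prod_{f\in E_2}y(f)\prod_{f\in E_1}z_f$; (cyclic) for each cycle $C$ (either two parallel edges, or one edge from each multi-edge) with a fixed orientation and partition $E(C)=C_1\cup C_2$ (one possibly empty), $E_1$ = edges of $C_1$ directed along, $E_2$ = edges of $C_2$ directed against the orientation: $\prod_{f\in E_1}y(f)\prod_{f\in E_2}z_f-\prod_{f\in E_2}y(f)\prod_{f\in E_1}z_f$. A set $S$ of variables contains a monomial if it contains every variable dividing it. A facet of $\mathcal{T}_{\mathbf{a}}$ is a set $S$ of $n+a_1+\cdots+a_n$ variables containing the $<$-leading monomial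 of no binomial in $B$; the simplices spanned by the corresponding lattice points form a unimodular triangulation $\mathcal{T}_{\mathbf{a}}$ of $\mathcal{C}_{C_{\mathbf{a}}}$. -}

module Defs where

open import Data.Nat using (ℕ; zero; suc; _+_; _*_; _∸_; _<_; _≤_)
open import Data.Nat.Properties using () renaming (_≟_ to _≟ℕ_)
open import Data.Fin using (Fin; zero; suc; toℕ; fromℕ; fromℕ<; inject₁) renaming (_<_ to _<ᶠ_)
open import Data.Fin.Properties using (_≟_)
open import Data.Bool using (Bool; true; false; if_then_else_)
open import Data.List using (List; []; _∷_; [_]; length; allFin; concatMap)
open import Data.List.Relation.Unary.All using (All)
open import Data.List.Relation.Unary.Unique.Propositional using (Unique)
open import Data.List.Membership.Propositional using (_∈_)
open import Data.Product using (Σ; ∃; _×_; _,_; proj₁; proj₂)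
open import Data.Product.Properties using () renaming (≡-dec to Σ-≡-dec)
open import Data.Sum using (_⊎_)
open import Relation.Nullary using (¬_; Dec; yes; no; does)
open import Relation.Binary.PropositionalEquality using (_≡_; _≢_)
open import Relation.Binary.Definitions using (DecidableEquality)
open import Function.Definitions using (Injective)
open import Relation.Nullary.Decidable using (⌊_⌋)

sucMod : ∀ {m} → Fin m → Fin m
sucMod {suc m} i with suc (toℕ i) Data.Nat.<? suc m
  where open import Data.Nat using (_<?_)
... | yes p = fromℕ< p
... | no _  = zero

count : ∀ {A : Set} {P : A → Set} → (∀ x → Dec (P x)) → List A → ℕ
count P? []       = 0
count P? (x ∷ xs) = (if does (P? x) then 1 else 0) + count P? xs

offset : ∀ {n} → (Fin n → ℕ) → Fin n → ℕ
offset a zero    = 0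
offset a (suc i) = a zero + offset (λ k → a (suc k)) i

total : ∀ {n} → (Fin n → ℕ) → ℕ
total {zero}  a = 0
total {suc n} a = a zero + total (λ k → a (suc k))

module _ {n : ℕ} (a : Fin n → ℕ) where

  -- The graph C_a on vertex set Fin n (paper's [n], shifted by one):
  -- the edge (i , j) is e^{(i)}_j, joining i and i+1 (mod n).
  Edge : Set
  Edge = Σ (Fin n) (λ i → Fin (a i))

  src tgt : Edge → Fin n
  src e = proj₁ e
  tgt e = sucMod (proj₁ e)

  Joins : Edge → Fin n → Fin n → Set
  Joins e x y = (x ≡ src e × y ≡ tgt e) ⊎ (x ≡ tgt e × y ≡ src e)

  data Var : Set where
    zv : Fin n → Var
    ze : Edge → Var
    tv : Edge → Var
    yR : Edge → Var      -- clockwise y^{(i)}_j  (i → i+1)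
    yL : Edge → Var      -- counter-clockwise y^{(i)}_j (i+1 → i)

  _≟E_ : DecidableEquality Edge
  _≟E_ = Σ-≡-dec _≟_ _≟_

  _≟V_ : DecidableEquality Var
  zv x ≟V zv y with x ≟ y
  ... | yes Relation.Binary.PropositionalEquality.refl = yes Relation.Binary.PropositionalEquality.refl
  ... | no ne = no λ { Relation.Binary.PropositionalEquality.refl → ne Relation.Binary.PropositionalEquality.refl }
  ze x ≟V ze y with x ≟E y
  ... | yes Relation.Binary.PropositionalEquality.refl = yes Relation.Binary.PropositionalEquality.refl
  ... | no ne = no λ { Relation.Binary.PropositionalEquality.refl → ne Relation.Binary.PropositionalEquality.refl }
  tv x ≟V tv y with x ≟E y
  ... | yes Relation.Binary.PropositionalEquality.refl = yes Relation.Binary.PropositionalEquality.refl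
  ... | no ne = no λ { Relation.Binary.PropositionalEquality.refl → ne Relation.Binary.PropositionalEquality.refl }
  yR x ≟V yR y with x ≟E y
  ... | yes Relation.Binary.PropositionalEquality.refl = yes Relation.Binary.PropositionalEquality.refl
  ... | no ne = no λ { Relation.Binary.PropositionalEquality.refl → ne Relation.Binary.PropositionalEquality.refl }
  yL x ≟V yL y with x ≟E y
  ... | yes Relation.Binary.PropositionalEquality.refl = yes Relation.Binary.PropositionalEquality.refl
  ... | no ne = no λ { Relation.Binary.PropositionalEquality.refl → ne Relation.Binary.PropositionalEquality.refl }
  zv _ ≟V ze _ = no λ ()
  zv _ ≟V tv _ = no λ ()
  zv _ ≟V yR _ = no λ ()
  zv _ ≟V yL _ = no λ ()
  ze _ ≟V zv _ = no λ ()
  ze _ ≟V tv _ = no λ ()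
  ze _ ≟V yR _ = no λ ()
  ze _ ≟V yL _ = no λ ()
  tv _ ≟V zv _ = no λ ()
  tv _ ≟V ze _ = no λ ()
  tv _ ≟V yR _ = no λ ()
  tv _ ≟V yL _ = no λ ()
  yR _ ≟V zv _ = no λ ()
  yR _ ≟V ze _ = no λ ()
  yR _ ≟V tv _ = no λ ()
  yR _ ≟V yL _ = no λ ()
  yL _ ≟V zv _ = no λ ()
  yL _ ≟V ze _ = no λ ()
  yL _ ≟V tv _ = no λ ()
  yL _ ≟V yR _ = no λ ()

  -- y(x → other endpoint of e): clockwise variable iff x is the source i of e
  yDir : Edge → Fin n → Var
  yDir e x = if ⌊ x ≟ src e ⌋ then yR e else yL e

  -- The variable order.  pos v = rank from the top: v > w iff pos v < pos w.
  --   y→(1,1) > ... > y→(n,a_n) > y←(n,a_n) > ... > y←(1,1)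
  --   > z(1,1) > ... > z(n,a_n) > t(1,1) > ... > t(n,a_n) > z_1 > ... > z_n

  N : ℕ
  N = total a

  idx : Edge → ℕ
  idx (i , j) = offset a i + toℕ j

  pos : Var → ℕ
  pos (yR e) = idx e
  pos (yL e) = N + (N ∸ suc (idx e))
  pos (ze e) = 2 * N + idx e
  pos (tv e) = 3 * N + idx e
  pos (zv k) = 4 * N + toℕ k

  _≻_ : Var → Var → Set
  v ≻ w = pos v < pos w

  Monomial : Set
  Monomial = List Var

  deg : Monomial → Var → ℕ
  deg m v = count (λ w → w ≟V v) m

  _>lex_ : Monomial → Monomial → Set
  m₁ >lex m₂ = Σ Var λ v → deg m₂ v < deg m₁ v × (∀ w → w ≻ v → deg m₁ w ≡ deg m₂ w)

  -- The binomial set B; a binomial m₁ - m₂ is encoded by the pair (m₁ , m₂).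

  data Fundamental : Monomial → Monomial → Set where
    f1 : ∀ e → Fundamental (yR e ∷ yL e ∷ []) (ze e ∷ ze e ∷ [])
    f2 : ∀ e → Fundamental (yR e ∷ tv e ∷ []) (zv (src e) ∷ zv (src e) ∷ [])
    f3 : ∀ e → Fundamental (yL e ∷ tv e ∷ []) (zv (tgt e) ∷ zv (tgt e) ∷ [])
    f4 : ∀ e → Fundamental (yR e ∷ zv (tgt e) ∷ []) (zv (src e) ∷ ze e ∷ [])
    f5 : ∀ e → Fundamental (yL e ∷ zv (src e) ∷ []) (zv (tgt e) ∷ ze e ∷ [])
    f6 : ∀ e → Fundamental (tv e ∷ ze e ∷ []) (zv (src e) ∷ zv (tgt e) ∷ [])

  -- A path of length L = m+2 ≥ 2: distinct vertices vert 0 (= u), ..., vert L (= v),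
  -- edge k joining vert k and vert (k+1).
  record Path (m : ℕ) : Set where
    field
      vert    : Fin (suc (suc (suc m))) → Fin n
      edge    : Fin (suc (suc m)) → Edge
      vertInj : Injective _≡_ _≡_ vert
      joins   : ∀ k → Joins (edge k) (vert (inject₁ k)) (vert (suc k))

  -- zig-zag binomial for path P and partition part (true = P₁, false = P₂),
  -- with the edge at u in P₁ and the edge at v in P₂.
  zigzagL zigzagR : ∀ {m} → Path m → (Fin (suc (suc m)) → Bool) → Monomial
  zigzagL {m} P part = zv (Path.vert P (fromℕ (suc (suc m)))) ∷
    concatMap (λ k → if part k then [ yDir (Path.edge P k) (Path.vert P (inject₁ k)) ]
                               else [ ze (Path.edge P k) ])
              (allFin (suc (suc m)))
  zigzagR {m} P part = zv (Path.vert P zero) ∷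
    concatMap (λ k → if part k then [ ze (Path.edge P k) ]
                               else [ yDir (Path.edge P k) (Path.vert P (suc k)) ])
              (allFin (suc (suc m)))

  data ZigZag : Monomial → Monomial → Set where
    zz : ∀ {m} (P : Path m) (part : Fin (suc (suc m)) → Bool) →
         part zero ≡ true → part (fromℕ (suc m)) ≡ false →
         ZigZag (zigzagL P part) (zigzagR P part)

  -- A cycle of length L = m+2 ≥ 2, traversed in the orientation
  -- vert 0 → vert 1 → ... → vert (L-1) → vert 0; distinct vertices and edges.
  record Cycle (m : ℕ) : Set where
    field
      vert    : Fin (suc (suc m)) → Fin n
      edge    : Fin (suc (suc m)) → Edge
      vertInj : Injective _≡_ _≡_ vert
      edgeInj : Injective _≡_ _≡_ edge
      joins   : ∀ k → Joins (edge k) (vert k) (vert (sucMod k))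

  -- cyclic binomial; part k = true means edge k ∈ C₁, false means ∈ C₂
  cycL cycR : ∀ {m} → Cycle m → (Fin (suc (suc m)) → Bool) → Monomial
  cycL {m} C part =
    concatMap (λ k → if part k then [ yDir (Cycle.edge C k) (Cycle.vert C k) ]
                               else [ ze (Cycle.edge C k) ])
              (allFin (suc (suc m)))
  cycR {m} C part =
    concatMap (λ k → if part k then [ ze (Cycle.edge C k) ]
                               else [ yDir (Cycle.edge C k) (Cycle.vert C (sucMod k)) ])
              (allFin (suc (suc m)))

  data Cyclic : Monomial → Monomial → Set where
    cyc : ∀ {m} (C : Cycle m) (part : Fin (suc (suc m)) → Bool) →
          Cyclic (cycL C part) (cycR C part)

  InB : Monomial → Monomial → Set
  InB m₁ m₂ = Fundamental m₁ m₂ ⊎ ZigZag m₁ m₂ ⊎ Cyclic m₁ m₂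

  Contains : List Var → Monomial → Set
  Contains S m = All (_∈ S) m

  ContainsLead : List Var → Monomial → Monomial → Set
  ContainsLead S m₁ m₂ = (m₁ >lex m₂ × Contains S m₁) ⊎ (m₂ >lex m₁ × Contains S m₂)

  IsFacet : List Var → Set
  IsFacet S = Unique S × length S ≡ n + total a
            × (∀ m₁ m₂ → InB m₁ m₂ → ¬ ContainsLead S m₁ m₂)

  mem : List Var → Var → ℕ
  mem S v = count (λ w → w ≟V v) S   -- = 1 if v ∈ S, 0 otherwise (S has no duplicates)

  cardV : List Var → Edge → ℕ
  cardV S e = mem S (yR e) + mem S (yL e) + mem S (tv e) + mem S (ze e)

  IsYRZ : List Var → Edge → Set
  IsYRZ S e = yR e ∈ S × ze e ∈ S × ¬ (yL e ∈ S) × ¬ (tv e ∈ S)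

  IsYLZ : List Var → Edge → Set
  IsYLZ S e = yL e ∈ S × ze e ∈ S × ¬ (yR e ∈ S) × ¬ (tv e ∈ S)

  OneIn : List Var → Edge → Var → Var → Set
  OneIn S e x x' = cardV S e ≡ 1 × (∀ v → v ∈ S → (v ≡ yR e ⊎ v ≡ yL e ⊎ v ≡ tv e ⊎ v ≡ ze e) → v ≡ x ⊎ v ≡ x')

  CaseA : List Var → Fin n → Set
  CaseA S i = Σ (Fin (a i)) λ j →
      IsYRZ S (i , j)
    × (∀ j' → IsYRZ S (i , j') → j' ≡ j)
    × (∀ k → k ≢ j →
         (k <ᶠ j → OneIn S (i , k) (tv (i , k)) (ze (i , k)))
       × (j <ᶠ k → OneIn S (i , k) (tv (i , k)) (yR (i , k))))

  CaseB : List Var → Fin n → Set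
  CaseB S i = Σ (Fin (a i)) λ j →
      IsYLZ S (i , j)
    × (∀ j' → IsYLZ S (i , j') → j' ≡ j)
    × (∀ k → k ≢ j →
         (k <ᶠ j → OneIn S (i , k) (tv (i , k)) (yL (i , k)))
       × (j <ᶠ k → OneIn S (i , k) (tv (i , k)) (ze (i , k))))

  CaseC : List Var → Fin n → Set
  CaseC S i = ∀ j → cardV S (i , j) ≡ 1

ExactlyOne : Set → Set → Set → Set
ExactlyOne A B C = (A × ¬ B × ¬ C) ⊎ (¬ A × B × ¬ C) ⊎ (¬ A × ¬ B × C)

{-# OPTIONS --safe #-}
-- Call an edge e heavy if S ∩ V(e) is {y→, z_e} or {y←, z_e}. The quadratic binomials leave at most one
-- variable in S ∩ V(e) unless e is heavy, and the cyclic binomials on two parallel edges allow at most one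
-- heavy edge per multi-edge and force the ordering conditions of (A) and (B). Counting,
--   n + Σ aᵢ = |S| ≤ #{k | z_k ∈ S} + Σ_e |S ∩ V(e)| ≤ #{k | z_k ∈ S} + #{heavy edges} + Σ aᵢ,
-- while the zig-zag and cyclic binomials bound #{k | z_k ∈ S} + #{heavy edges} by n: a heavy edge is an
-- arrow into the endpoint its y-variable points to, and where two arrows meet, a run of y←-edges starts
-- that has to end at a vertex k with z_k ∉ S. So equality holds throughout: no S ∩ V(e) is empty, and the
-- heavy edge of the i-th multi-edge, of type y→, of type y← or absent, puts us in case (A), (B) or (C).
module Submission where

open import Defs
open import Data.Nat using (ℕ; zero; suc; _+_; _*_; _⊔_; _≤_; _<_; z≤n; s≤s; z<s; s<s; _<?_; _≟_)
open import Data.Nat.Properties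
open import Data.Nat.Solver using (module +-*-Solver)
open import Algebra.Properties.CommutativeSemigroup +-commutativeSemigroup using (interchange; xy∙z≈zx∙y)
open import Data.Bool using (Bool; true; false; not; if_then_else_)
open import Data.Fin using (Fin; zero; suc; toℕ; inject₁) renaming (_<_ to _<ᶠ_)
open import Data.Fin.Properties
  using (toℕ-injective; toℕ<n; toℕ-fromℕ<; toℕ-inject₁; toℕ-fromℕ; all?; any?; ¬∀⟶∃¬)
  renaming (_≟_ to _≟ᶠ_; <⇒≢ to <ᶠ⇒≢; <-cmp to <ᶠ-cmp; suc-injective to suc-injectiveᶠ)
open import Data.List using (List; []; _∷_; [_]; length; concatMap; allFin)
open import Data.List.Relation.Unary.All as All using (All; []; _∷_)
open import Data.List.Relation.Unary.All.Properties using (All¬⇒¬Any; concat⁺; map⁺; tabulate⁺)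
open import Data.List.Relation.Unary.Any using (here; there)
open import Data.List.Relation.Unary.AllPairs using (_∷_)
open import Data.List.Relation.Unary.Unique.Propositional using (Unique)
open import Data.List.Membership.Propositional using (_∈_; _∉_)
import Data.List.Membership.DecPropositional as DecMembership
open import Data.Product using (Σ; ∃; _×_; _,_; proj₁; proj₂)
open import Data.Sum as Sum using (_⊎_; inj₁; inj₂)
open import Data.Empty using (⊥; ⊥-elim)
open import Function using (_∘_)
open import Relation.Nullary using (¬_; Dec; yes; no; does; contradiction)
open import Relation.Nullary.Decidable using (dec-true; _×-dec_; _⊎-dec_)
open import Relation.Binary.Definitions using (DecidableEquality; tri<; tri≈; tri>)
open import Relation.Binary.PropositionalEquality hiding ([_])

≤1-cases : ∀ {x} → x ≤ 1 → x ≡ 0 ⊎ x ≡ 1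
≤1-cases z≤n       = inj₁ refl
≤1-cases (s≤s z≤n) = inj₂ refl

exclusive-≤1 : ∀ {x y} → x ≤ 1 → y ≤ 1 → (x ≡ 1 → y ≡ 1 → ⊥) → x + y ≤ 1
exclusive-≤1 x≤1 y≤1 excl with ≤1-cases x≤1 | ≤1-cases y≤1
... | inj₁ refl | _         = y≤1
... | inj₂ refl | inj₁ refl = s≤s z≤n
... | inj₂ refl | inj₂ refl = contradiction refl (excl refl)

pairwise-≤1 : ∀ {x y w} → x + y ≤ 1 → x + w ≤ 1 → y + w ≤ 1 → x + y + w ≤ 1
pairwise-≤1 {zero}                     _        _        y+w≤1 = y+w≤1
pairwise-≤1 {suc zero}    {zero} {zero}  _        _        _     = s≤s z≤n
pairwise-≤1 {suc zero}    {suc _}        (s≤s ()) _        _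
pairwise-≤1 {suc zero}    {zero} {suc _} _        (s≤s ()) _
pairwise-≤1 {suc (suc _)}                (s≤s ()) _        _

+≤1⇒+≡⊔ : ∀ {x y} → x + y ≤ 1 → x + y ≡ x ⊔ y
+≤1⇒+≡⊔ {zero}                 _        = refl
+≤1⇒+≡⊔ {suc zero}    {zero}   _        = refl
+≤1⇒+≡⊔ {suc zero}    {suc _}  (s≤s ())
+≤1⇒+≡⊔ {suc (suc _)}          (s≤s ())

total-cong : ∀ {k} {f g : Fin k → ℕ} → (∀ i → f i ≡ g i) → total f ≡ total g
total-cong {zero}  _   = refl
total-cong {suc k} f≗g = cong₂ _+_ (f≗g zero) (total-cong (f≗g ∘ suc))

total-+ : ∀ {k} (f g : Fin k → ℕ) → total (λ i → f i + g i) ≡ total f + total g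
total-+ {zero}  f g = refl
total-+ {suc k} f g = trans (cong (f zero + g zero +_) (total-+ (f ∘ suc) (g ∘ suc)))
                            (interchange (f zero) (g zero) _ _)

total-mono-≤ : ∀ {k} {f g : Fin k → ℕ} → (∀ i → f i ≤ g i) → total f ≤ total g
total-mono-≤ {zero}  _   = z≤n
total-mono-≤ {suc k} f≤g = +-mono-≤ (f≤g zero) (total-mono-≤ (f≤g ∘ suc))

total-const : ∀ k c → total {k} (λ _ → c) ≡ k * c
total-const zero    c = refl
total-const (suc k) c = cong (c +_) (total-const k c)

term≤total : ∀ {k} (f : Fin k → ℕ) i → f i ≤ total f
term≤total f zero    = m≤m+n _ _
term≤total f (suc i) = ≤-trans (term≤total (f ∘ suc) i) (m≤n+m _ (f zero))

total-nonzero : ∀ {k} (f : Fin k → ℕ) → total f ≢ 0 → ∃ λ i → f i ≢ 0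
total-nonzero {zero}  f Σf≢0 = contradiction refl Σf≢0
total-nonzero {suc k} f Σf≢0 with f zero ≟ 0
... | no  f₀≢0 = zero , f₀≢0
... | yes f₀≡0 with total-nonzero (f ∘ suc) (Σf≢0 ∘ trans (cong (_+ total (λ i → f (suc i))) f₀≡0))
...   | i , fᵢ≢0 = suc i , fᵢ≢0

total-≤1 : ∀ {k} (f : Fin k → ℕ) → (∀ i → f i ≤ 1) →
           (∀ i j → f i ≡ 1 → f j ≡ 1 → i ≡ j) → total f ≤ 1
total-≤1 {zero}  f _   _      = z≤n
total-≤1 {suc k} f f≤1 unique with ≤1-cases (f≤1 zero)
... | inj₁ f₀≡0 rewrite f₀≡0 =
  total-≤1 (f ∘ suc) (f≤1 ∘ suc) (λ i j p q → suc-injectiveᶠ (unique (suc i) (suc j) p q))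
... | inj₂ f₀≡1 rewrite f₀≡1 =
  s≤s (≤-trans (total-mono-≤ rest≤0) (≤-reflexive (trans (total-const k 0) (*-zeroʳ k))))
  where
  rest≤0 : ∀ i → f (suc i) ≤ 0
  rest≤0 i with ≤1-cases (f≤1 (suc i))
  ... | inj₁ fᵢ≡0 = ≤-reflexive fᵢ≡0
  ... | inj₂ fᵢ≡1 with unique zero (suc i) f₀≡1 fᵢ≡1
  ...   | ()

total-tight⇒pointwise-≡ : ∀ {k} {f g : Fin k → ℕ} → (∀ i → f i ≤ g i) → total g ≤ total f → ∀ i → f i ≡ g i
total-tight⇒pointwise-≡ {suc k} {f} {g} f≤g Σg≤Σf zero =
  ≤-antisym (f≤g zero) (+-cancelʳ-≤ _ _ _ (≤-trans Σg≤Σf (+-monoʳ-≤ (f zero) (total-mono-≤ (f≤g ∘ suc)))))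
total-tight⇒pointwise-≡ {suc k} {f} {g} f≤g Σg≤Σf (suc i) =
  total-tight⇒pointwise-≡ (f≤g ∘ suc) (+-cancelˡ-≤ (g zero) _ _ (≤-trans Σg≤Σf (+-monoˡ-≤ _ (f≤g zero)))) i

sumBelow : ℕ → (ℕ → ℕ) → ℕ
sumBelow k f = total {k} (λ i → f (toℕ i))

sumBelow-+ : ∀ k f g → sumBelow k (λ t → f t + g t) ≡ sumBelow k f + sumBelow k g
sumBelow-+ k f g = total-+ {k} (f ∘ toℕ) (g ∘ toℕ)

sumBelow-shift : ∀ k f → sumBelow k (λ t → f (suc t)) + f 0 ≡ sumBelow k f + f k
sumBelow-shift zero    f = refl
sumBelow-shift (suc k) f = begin
  f 1 + sumBelow k (λ t → f (2 + t)) + f 0        ≡⟨ cong (_+ f 0) (+-comm (f 1) _) ⟩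
  sumBelow k (λ t → f (2 + t)) + f 1 + f 0        ≡⟨ cong (_+ f 0) (sumBelow-shift k (λ t → f (suc t))) ⟩
  sumBelow k (λ t → f (suc t)) + f (suc k) + f 0  ≡⟨ xy∙z≈zx∙y (sumBelow k (λ t → f (suc t))) (f (suc k)) (f 0) ⟩
  f 0 + sumBelow k (λ t → f (suc t)) + f (suc k)  ∎
  where open ≡-Reasoning

sumBelow-rotate : ∀ k f → f k ≡ f 0 → sumBelow k (λ t → f (suc t)) ≡ sumBelow k f
sumBelow-rotate k f fₖ≡f₀ =
  +-cancelʳ-≡ (f 0) _ _ (trans (sumBelow-shift k f) (cong (sumBelow k f +_) fₖ≡f₀))

module Count {A : Set} (_≟ᴬ_ : DecidableEquality A) where

  open DecMembership _≟ᴬ_ using (_∈?_)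

  count-∉ : ∀ {v xs} → v ∉ xs → count (λ w → w ≟ᴬ v) xs ≡ 0
  count-∉ {v} {[]}     _   = refl
  count-∉ {v} {x ∷ xs} v∉ with x ≟ᴬ v
  ... | yes refl = contradiction (here refl) v∉
  ... | no  _    = count-∉ (v∉ ∘ there)

  count-∈ : ∀ {v xs} → v ∈ xs → 1 ≤ count (λ w → w ≟ᴬ v) xs
  count-∈ {v} (here refl) with v ≟ᴬ v
  ... | yes _  = s≤s z≤n
  ... | no v≢v = contradiction refl v≢v
  count-∈ {v} {x ∷ xs} (there v∈) = ≤-trans (count-∈ v∈) (m≤n+m _ _)

  ∈-of-count : ∀ {v xs} → count (λ w → w ≟ᴬ v) xs ≢ 0 → v ∈ xs
  ∈-of-count {v} {xs} count≢0 with v ∈? xs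
  ... | yes v∈ = v∈
  ... | no  v∉ = contradiction (count-∉ v∉) count≢0

  count-≤1 : ∀ {v xs} → Unique xs → count (λ w → w ≟ᴬ v) xs ≤ 1
  count-≤1 {v} {[]}     _               = z≤n
  count-≤1 {v} {x ∷ xs} (x∉xs ∷ unique) with x ≟ᴬ v
  ... | yes refl = s≤s (≤-reflexive (count-∉ (All¬⇒¬Any x∉xs)))
  ... | no  _    = count-≤1 unique

module _ {m : ℕ} where

  toℕ-sucMod : (x : Fin (suc m)) → suc (toℕ x) < suc m → toℕ (sucMod x) ≡ suc (toℕ x)
  toℕ-sucMod x bound with suc (toℕ x) <? suc m
  ... | yes p = toℕ-fromℕ< p
  ... | no ¬p = contradiction bound ¬p

  sucMod-last : (x : Fin (suc m)) → toℕ x ≡ m → sucMod x ≡ zero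
  sucMod-last x x≡m with suc (toℕ x) <? suc m
  ... | yes p = contradiction (subst (λ t → suc t < suc m) x≡m p) (<-irrefl refl)
  ... | no _  = refl

  toℕ-maximal : (x : Fin (suc m)) → m ≤ toℕ x → toℕ x ≡ m
  toℕ-maximal x = ≤-antisym (≤-pred (toℕ<n x))

  sucMod-injective : ∀ {x y : Fin (suc m)} → sucMod x ≡ sucMod y → x ≡ y
  sucMod-injective {x} {y} eq with suc (toℕ x) <? suc m | suc (toℕ y) <? suc m
  ... | yes p | yes q =
    toℕ-injective (suc-injective (trans (sym (toℕ-fromℕ< p)) (trans (cong toℕ eq) (toℕ-fromℕ< q))))
  ... | yes p | no _  = contradiction (trans (sym (toℕ-fromℕ< p)) (cong toℕ eq)) λ ()
  ... | no _  | yes q = contradiction (trans (cong toℕ eq) (toℕ-fromℕ< q)) λ ()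
  ... | no ¬p | no ¬q =
    toℕ-injective (trans (toℕ-maximal x (≤-pred (≮⇒≥ ¬p))) (sym (toℕ-maximal y (≤-pred (≮⇒≥ ¬q)))))

  -- p mod n as a vertex of the n-cycle, defined by iterating sucMod so that
  -- wrap (suc p) ≡ sucMod (wrap p) holds definitionally.
  wrap : ℕ → Fin (suc m)
  wrap zero    = zero
  wrap (suc p) = sucMod (wrap p)

  toℕ-wrap : ∀ {t} → t < suc m → toℕ (wrap t) ≡ t
  toℕ-wrap {zero}  _     = refl
  toℕ-wrap {suc t} bound =
    trans (toℕ-sucMod (wrap t) (subst (λ x → suc x < suc m) (sym t≡) bound)) (cong suc t≡)
    where
    t≡ : toℕ (wrap t) ≡ t
    t≡ = toℕ-wrap (<-trans (n<1+n t) bound)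

  wrap-toℕ : (k : Fin (suc m)) → wrap (toℕ k) ≡ k
  wrap-toℕ k = toℕ-injective (toℕ-wrap (toℕ<n k))

  wrap-+n : ∀ p → wrap (p + suc m) ≡ wrap p
  wrap-+n zero    = sucMod-last (wrap m) (toℕ-wrap (n<1+n m))
  wrap-+n (suc p) = cong sucMod (wrap-+n p)

  wrap-n+ : ∀ p → wrap (suc m + p) ≡ wrap p
  wrap-n+ p = trans (cong wrap (+-comm (suc m) p)) (wrap-+n p)

  wrap-cancelˡ : ∀ s {t u} → wrap (s + t) ≡ wrap (s + u) → wrap t ≡ wrap u
  wrap-cancelˡ zero    eq = eq
  wrap-cancelˡ (suc s) eq = wrap-cancelˡ s (sucMod-injective eq)

  wrap-injective : ∀ s {t u} → t < suc m → u < suc m → wrap (t + s) ≡ wrap (u + s) → t ≡ u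
  wrap-injective s {t} {u} t<n u<n eq = begin
    t             ≡⟨ toℕ-wrap t<n ⟨
    toℕ (wrap t)  ≡⟨ cong toℕ (wrap-cancelˡ s (subst₂ (λ x y → wrap x ≡ wrap y) (+-comm t s) (+-comm u s) eq)) ⟩
    toℕ (wrap u)  ≡⟨ toℕ-wrap u<n ⟩
    u             ∎
    where open ≡-Reasoning

  sucMod≢id : 1 < suc m → (x : Fin (suc m)) → sucMod x ≢ x
  sucMod≢id 1<n x eq
    with wrap-injective (toℕ x) 1<n z<s (trans (cong sucMod (wrap-toℕ x)) (trans eq (sym (wrap-toℕ x))))
  ... | ()

  wrap-sucMod : ∀ s (k : Fin (suc m)) → wrap (toℕ (sucMod k) + s) ≡ sucMod (wrap (toℕ k + s))
  wrap-sucMod s k with toℕ k <? m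
  ... | yes k<m = cong (λ t → wrap (t + s)) (toℕ-sucMod k (s<s k<m))
  ... | no  k≮m = trans (cong (λ x → wrap (toℕ x + s)) (sucMod-last k k≡m))
                        (sym (trans (cong (λ t → wrap (suc t + s)) k≡m) (wrap-n+ s)))
    where
    k≡m : toℕ k ≡ m
    k≡m = toℕ-maximal k (≮⇒≥ k≮m)

  sumBelow-wrap-suc : ∀ p (F : Fin (suc m) → ℕ) →
    sumBelow (suc m) (λ t → F (wrap (suc t + p))) ≡ sumBelow (suc m) (λ t → F (wrap (t + p)))
  sumBelow-wrap-suc p F = sumBelow-rotate (suc m) (λ t → F (wrap (t + p))) (cong F (wrap-n+ p))

  sumBelow-wrap : ∀ p (F : Fin (suc m) → ℕ) → sumBelow (suc m) (λ t → F (wrap (t + p))) ≡ total F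
  sumBelow-wrap zero    F =
    total-cong {suc m} (λ k → cong F (trans (cong wrap (+-identityʳ (toℕ k))) (wrap-toℕ k)))
  sumBelow-wrap (suc p) F = begin
    sumBelow (suc m) (λ t → F (wrap (t + suc p)))  ≡⟨ total-cong {suc m} (λ k → cong (F ∘ wrap) (+-suc (toℕ k) p)) ⟩
    sumBelow (suc m) (λ t → F (wrap (suc t + p)))  ≡⟨ sumBelow-wrap-suc p F ⟩
    sumBelow (suc m) (λ t → F (wrap (t + p)))      ≡⟨ sumBelow-wrap p F ⟩
    total F                                        ∎
    where open ≡-Reasoning

allFin-concatMap⁺ : ∀ {A : Set} {P : A → Set} {k} (f : Fin k → List A) → (∀ i → All P (f i)) →
                    All P (concatMap f (allFin k))
allFin-concatMap⁺ f Pf = concat⁺ (map⁺ (tabulate⁺ Pf))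

-- Edge i of the n-cycle joins the vertices i and i + 1; r i and l i mark an arrow on edge i pointing to
-- i + 1 and to i respectively, and z k marks the vertex k.
module ArrowsAndMarks {m : ℕ} (r z l : Fin (suc m) → ℕ)
  (r+l≤1 : ∀ i → r i + l i ≤ 1)
  (z+l≤1 : ∀ i → z i + l i ≤ 1)
  (no-run : ∀ s k → k < suc m → r (wrap s) ≡ 1 → (∀ u → u < k → l (wrap (suc u + s)) ≡ 1) →
            z (wrap (suc k + s)) ≡ 1 → ⊥)
  where

  r≤1 : ∀ i → r i ≤ 1
  r≤1 i = m+n≤o⇒m≤o (r i) (r+l≤1 i)

  l≤1 : ∀ i → l i ≤ 1
  l≤1 i = m+n≤o⇒n≤o (r i) (r+l≤1 i)

  z≤1 : ∀ i → z i ≤ 1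
  z≤1 i = m+n≤o⇒m≤o (z i) (z+l≤1 i)

  l≡1⇒z≡0 : ∀ i → l i ≡ 1 → z i ≡ 0
  l≡1⇒z≡0 i lᵢ≡1 = n≤0⇒n≡0 (+-cancelʳ-≤ 1 _ 0 (subst (λ x → z i + x ≤ 1) lᵢ≡1 (z+l≤1 i)))

  l≡1⇒r≡0 : ∀ i → l i ≡ 1 → r i ≡ 0
  l≡1⇒r≡0 i lᵢ≡1 = n≤0⇒n≡0 (+-cancelʳ-≤ 1 _ 0 (subst (λ x → r i + x ≤ 1) lᵢ≡1 (r+l≤1 i)))

  bound-when-all-l : (∀ i → l i ≡ 1) → total r + total z + total l ≤ suc m
  bound-when-all-l all-l = begin
    total r + total z + total l                ≡⟨ cong (_+ total l) (total-+ r z) ⟨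
    total (λ i → r i + z i) + total l          ≡⟨ total-+ (λ i → r i + z i) l ⟨
    total (λ i → r i + z i + l i)              ≤⟨ total-mono-≤ one ⟩
    total {suc m} (λ _ → 1)                    ≡⟨ trans (total-const (suc m) 1) (*-identityʳ (suc m)) ⟩
    suc m                                      ∎
    where
    open ≤-Reasoning
    one : ∀ i → r i + z i + l i ≤ 1
    one i rewrite l≡1⇒r≡0 i (all-l i) | l≡1⇒z≡0 i (all-l i) | all-l i = ≤-refl

  -- An amortised count, walking clockwise from an edge p₀ without l-arrow: carry t = 1 when a vertex hit by
  -- two arrows passes its surplus along the run of l-arrows that ends at edge t + p₀; by no-run that run
  -- ends at an unmarked vertex, which absorbs it.
  module Carry (p₀ : ℕ) (l₀≡0 : l (wrap p₀) ≡ 0) where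

    carry : ℕ → ℕ
    carry zero    = 0
    carry (suc t) = l (wrap (suc t + p₀)) * (r (wrap (t + p₀)) ⊔ carry t)

    carry≤1 : ∀ t → carry t ≤ 1
    carry≤1 zero    = z≤n
    carry≤1 (suc t) = *-mono-≤ (l≤1 _) (⊔-lub (r≤1 _) (carry≤1 t))

    carry⇒l : ∀ t → carry t ≡ 1 → l (wrap (t + p₀)) ≡ 1
    carry⇒l zero    ()
    carry⇒l (suc t) eq = m*n≡1⇒m≡1 _ _ eq

    r+carry≤1 : ∀ t → r (wrap (t + p₀)) + carry t ≤ 1
    r+carry≤1 t with ≤1-cases (carry≤1 t)
    ... | inj₁ c≡0 rewrite c≡0 | +-identityʳ (r (wrap (t + p₀))) = r≤1 _
    ... | inj₂ c≡1 rewrite c≡1 = subst (λ x → r (wrap (t + p₀)) + x ≤ 1) (carry⇒l t c≡1) (r+l≤1 _)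

    carry-blocks-mark : ∀ t k → t + k < suc m → carry t ≡ 1 →
      (∀ u → u < k → l (wrap (suc u + (t + p₀))) ≡ 1) → z (wrap (suc k + (t + p₀))) ≡ 1 → ⊥
    carry-blocks-mark zero    _ _     ()  _   _
    carry-blocks-mark (suc t) k bound eq run mark = blocked (⊔-sel (r (wrap (t + p₀))) (carry t))
      where
      run′ : ∀ u → u < suc k → l (wrap (suc u + (t + p₀))) ≡ 1
      run′ zero    _         = m*n≡1⇒m≡1 _ _ eq
      run′ (suc u) (s≤s u<k) = subst (λ p → l (wrap (suc p)) ≡ 1) (+-suc u (t + p₀)) (run u u<k)
      mark′ : z (wrap (suc (suc k) + (t + p₀))) ≡ 1
      mark′ = subst (λ p → z (wrap (suc p)) ≡ 1) (+-suc k (t + p₀)) mark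
      arrives : r (wrap (t + p₀)) ⊔ carry t ≡ 1
      arrives = m*n≡1⇒n≡1 (l (wrap (suc t + p₀))) _ eq
      blocked : r (wrap (t + p₀)) ⊔ carry t ≡ r (wrap (t + p₀)) ⊎ r (wrap (t + p₀)) ⊔ carry t ≡ carry t → ⊥
      blocked (inj₁ ⊔≡r) = no-run (t + p₀) (suc k) (≤-<-trans (s≤s (m≤n+m k t)) bound)
                             (trans (sym ⊔≡r) arrives) run′ mark′
      blocked (inj₂ ⊔≡c) = carry-blocks-mark t (suc k) (subst (_< suc m) (sym (+-suc t k)) bound)
                             (trans (sym ⊔≡c) arrives) run′ mark′

    step : ∀ t → t < suc m →
      r (wrap (t + p₀)) + z (wrap (suc t + p₀)) + l (wrap (suc t + p₀)) + carry t ≤ 1 + carry (suc t)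
    step t t<n with ≤1-cases (l≤1 (wrap (suc t + p₀)))
    ... | inj₂ l≡1 rewrite l≡1 | l≡1⇒z≡0 _ l≡1 = ≤-reflexive (begin
      r′ + 0 + 1 + c       ≡⟨ cong (λ x → x + 1 + c) (+-identityʳ r′) ⟩
      r′ + 1 + c           ≡⟨ cong (_+ c) (+-comm r′ 1) ⟩
      1 + (r′ + c)         ≡⟨ cong suc (+≤1⇒+≡⊔ {r′} {c} (r+carry≤1 t)) ⟩
      1 + (r′ ⊔ c)         ≡⟨ cong suc (+-identityʳ (r′ ⊔ c)) ⟨
      1 + (r′ ⊔ c + 0)     ∎)
      where
      open ≡-Reasoning
      r′ = r (wrap (t + p₀))
      c  = carry t
    ... | inj₁ l≡0 rewrite l≡0 | +-identityʳ (r (wrap (t + p₀)) + z (wrap (suc t + p₀))) =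
      pairwise-≤1 {r (wrap (t + p₀))} {z (wrap (suc t + p₀))} {carry t} r+z≤1 (r+carry≤1 t) z+carry≤1
      where
      r+z≤1 : r (wrap (t + p₀)) + z (wrap (suc t + p₀)) ≤ 1
      r+z≤1 = exclusive-≤1 (r≤1 _) (z≤1 _) (λ r≡1 z≡1 → no-run (t + p₀) 0 z<s r≡1 (λ _ ()) z≡1)
      z+carry≤1 : z (wrap (suc t + p₀)) + carry t ≤ 1
      z+carry≤1 = exclusive-≤1 (z≤1 _) (carry≤1 t) (λ z≡1 c≡1 →
        carry-blocks-mark t 0 (subst (_< suc m) (sym (+-identityʳ t)) t<n) c≡1 (λ _ ()) z≡1)

    carry-periodic : carry (suc m) ≡ carry 0
    carry-periodic = cong (_* (r (wrap (m + p₀)) ⊔ carry m)) (trans (cong l (wrap-n+ p₀)) l₀≡0)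

    bound : total r + total z + total l ≤ suc m
    bound = +-cancelʳ-≤ (sumBelow (suc m) carry) _ _ (begin
      total r + total z + total l + sumBelow (suc m) carry
        ≡⟨ cong (_+ sumBelow (suc m) carry) arrivals ⟨
      sumBelow (suc m) arrived + sumBelow (suc m) carry
        ≡⟨ sumBelow-+ (suc m) arrived carry ⟨
      sumBelow (suc m) (λ t → arrived t + carry t)
        ≤⟨ total-mono-≤ {suc m} (λ i → step (toℕ i) (toℕ<n i)) ⟩
      sumBelow (suc m) (λ t → 1 + carry (suc t))
        ≡⟨ sumBelow-+ (suc m) (λ _ → 1) (λ t → carry (suc t)) ⟩
      total {suc m} (λ _ → 1) + sumBelow (suc m) (λ t → carry (suc t))
        ≡⟨ cong₂ _+_ (trans (total-const (suc m) 1) (*-identityʳ (suc m)))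
                     (sumBelow-rotate (suc m) carry carry-periodic) ⟩
      suc m + sumBelow (suc m) carry
        ∎)
      where
      open ≤-Reasoning
      R Z L : ℕ → ℕ
      R t = r (wrap (t + p₀))
      Z t = z (wrap (suc t + p₀))
      L t = l (wrap (suc t + p₀))
      arrived : ℕ → ℕ
      arrived t = R t + Z t + L t
      arrivals : sumBelow (suc m) arrived ≡ total r + total z + total l
      arrivals = begin-equality
        sumBelow (suc m) arrived
          ≡⟨ sumBelow-+ (suc m) (λ t → R t + Z t) L ⟩
        sumBelow (suc m) (λ t → R t + Z t) + sumBelow (suc m) L
          ≡⟨ cong (_+ sumBelow (suc m) L) (sumBelow-+ (suc m) R Z) ⟩
        sumBelow (suc m) R + sumBelow (suc m) Z + sumBelow (suc m) L
          ≡⟨ cong₂ _+_ (cong₂ _+_ (sumBelow-wrap p₀ r) (trans (sumBelow-wrap-suc p₀ z) (sumBelow-wrap p₀ z)))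
                       (trans (sumBelow-wrap-suc p₀ l) (sumBelow-wrap p₀ l)) ⟩
        total r + total z + total l ∎

  arrows+marks≤n : total r + total z + total l ≤ suc m
  arrows+marks≤n with all? (λ i → l i ≟ 1)
  ... | yes all-l = bound-when-all-l all-l
  ... | no ¬all-l with ¬∀⟶∃¬ _ _ (λ i → l i ≟ 1) ¬all-l
  ...   | i , lᵢ≢1 = Carry.bound (toℕ i) (trans (cong l (wrap-toℕ i)) l≡0)
    where
    l≡0 : l i ≡ 0
    l≡0 with ≤1-cases (l≤1 i)
    ... | inj₁ eq = eq
    ... | inj₂ eq = contradiction eq lᵢ≢1

offset+size≤total : ∀ {n} (a : Fin n → ℕ) i → offset a i + a i ≤ total a
offset+size≤total a zero    = m≤m+n (a zero) _
offset+size≤total a (suc i) = subst (_≤ total a) (sym (+-assoc (a zero) _ _))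
  (+-monoʳ-≤ (a zero) (offset+size≤total (λ k → a (suc k)) i))

interchange₄ : ∀ a b c d a′ b′ c′ d′ →
  a + a′ + (b + b′) + (c + c′) + (d + d′) ≡ a + b + c + d + (a′ + b′ + c′ + d′)
interchange₄ a b c d a′ b′ c′ d′ = begin
  a + a′ + (b + b′) + (c + c′) + (d + d′)   ≡⟨ cong (λ x → x + (c + c′) + (d + d′)) (interchange a a′ b b′) ⟩
  a + b + (a′ + b′) + (c + c′) + (d + d′)   ≡⟨ cong (_+ (d + d′)) (interchange (a + b) (a′ + b′) c c′) ⟩
  a + b + c + (a′ + b′ + c′) + (d + d′)     ≡⟨ interchange (a + b + c) (a′ + b′ + c′) d d′ ⟩
  a + b + c + d + (a′ + b′ + c′ + d′)       ∎
  where open ≡-Reasoning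

module Order {n : ℕ} (a : Fin n → ℕ) where

  open Count (_≟V_ a)

  idx<N : ∀ e → idx a e < N a
  idx<N (i , j) = <-≤-trans (+-monoʳ-< (offset a i) (toℕ<n j)) (offset+size≤total a i)

  tier : Var a → ℕ
  tier (yR _) = 0
  tier (yL _) = 1
  tier (ze _) = 2
  tier (tv _) = 3
  tier (zv _) = 4

  tier≤4 : ∀ v → tier v ≤ 4
  tier≤4 (yR _) = z≤n
  tier≤4 (yL _) = s≤s z≤n
  tier≤4 (ze _) = s≤s (s≤s z≤n)
  tier≤4 (tv _) = s≤s (s≤s (s≤s z≤n))
  tier≤4 (zv _) = ≤-refl

  tier-lower : ∀ v → tier v * N a ≤ pos a v
  tier-lower (yR _) = z≤n
  tier-lower (yL _) = +-monoʳ-≤ (N a) z≤n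
  tier-lower (ze _) = m≤m+n _ _
  tier-lower (tv _) = m≤m+n _ _
  tier-lower (zv _) = m≤m+n _ _

  next-tier : ∀ t {x} → x < N a → t * N a + x < suc t * N a
  next-tier t {x} x<N = subst (t * N a + x <_) (+-comm (t * N a) (N a)) (+-monoʳ-< (t * N a) x<N)

  tier-upper : ∀ v → tier v < 4 → pos a v < suc (tier v) * N a
  tier-upper (yR e) _ = next-tier 0 (idx<N e)
  tier-upper (yL e) _ =
    +-monoʳ-< (N a) (<-≤-trans (∸-monoʳ-< z<s (idx<N e)) (≤-reflexive (sym (+-identityʳ (N a)))))
  tier-upper (ze e) _ = next-tier 2 (idx<N e)
  tier-upper (tv e) _ = next-tier 3 (idx<N e)
  tier-upper (zv _) (s≤s (s≤s (s≤s (s≤s ()))))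

  ≻-tier : ∀ {v w} → tier v < tier w → _≻_ a v w
  ≻-tier {v} {w} lt =
    <-≤-trans (tier-upper v (<-≤-trans lt (tier≤4 w))) (≤-trans (*-monoˡ-≤ (N a) lt) (tier-lower w))

  yL-≻ : ∀ e e′ → idx a e′ < idx a e → _≻_ a (yL e) (yL e′)
  yL-≻ e e′ lt = +-monoʳ-< (N a) (∸-monoʳ-< (s<s lt) (idx<N e))

  idx-mono : ∀ i {j k : Fin (a i)} → j <ᶠ k → idx a (i , j) < idx a (i , k)
  idx-mono i = +-monoʳ-< (offset a i)

  -- Comparisons across tiers are supplied as tier inequalities: these are between numerals and are
  -- checked by evaluation, whereas _≻_ a v w unfolds to positions that block unification.
  Above : Var a → Var a → Set
  Above v w = tier v < tier w ⊎ _≻_ a v w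

  above⇒≻ : ∀ {v w} → Above v w → _≻_ a v w
  above⇒≻ {v} {w} (inj₁ lt) = ≻-tier {v} {w} lt
  above⇒≻         (inj₂ v≻w) = v≻w

  >lex-from-top : ∀ {m₁ m₂ v} → v ∈ m₁ → All (λ w → w ≡ v ⊎ _≻_ a v w) m₁ → All (_≻_ a v) m₂ →
                  _>lex_ a m₁ m₂
  >lex-from-top {m₁} {m₂} {v} v∈m₁ below₁ below₂ = v , fewer , equal-above
    where
    v∉m₂ : v ∉ m₂
    v∉m₂ v∈m₂ = <-irrefl refl (All.lookup below₂ v∈m₂)
    fewer : deg a m₂ v < deg a m₁ v
    fewer = subst (_< deg a m₁ v) (sym (count-∉ v∉m₂)) (count-∈ v∈m₁)
    equal-above : ∀ w → _≻_ a w v → deg a m₁ w ≡ deg a m₂ w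
    equal-above w w≻v = trans (count-∉ w∉m₁) (sym (count-∉ w∉m₂))
      where
      w∉m₁ : w ∉ m₁
      w∉m₁ w∈m₁ with All.lookup below₁ w∈m₁
      ... | inj₁ w≡v = <-irrefl (cong (pos a) w≡v) w≻v
      ... | inj₂ v≻w = <-asym v≻w w≻v
      w∉m₂ : w ∉ m₂
      w∉m₂ w∈m₂ = <-asym (All.lookup below₂ w∈m₂) w≻v

module VarSum {n : ℕ} (a : Fin n → ℕ) where

  edgeSum : (Var a → ℕ) → Edge a → ℕ
  edgeSum f e = f (yR e) + f (yL e) + f (tv e) + f (ze e)

  ∑Var : (Var a → ℕ) → ℕ
  ∑Var f = total (λ k → f (zv k)) + total (λ i → total (λ j → edgeSum f (i , j)))

  ∑Var-+ : ∀ f g → ∑Var (λ v → f v + g v) ≡ ∑Var f + ∑Var g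
  ∑Var-+ f g = trans (cong₂ _+_ (total-+ (λ k → f (zv k)) (λ k → g (zv k))) edges)
                     (interchange (total (λ k → f (zv k))) (total (λ k → g (zv k))) (Σedges f) (Σedges g))
    where
    Σedges : (Var a → ℕ) → ℕ
    Σedges h = total (λ i → total (λ j → edgeSum h (i , j)))
    regroup : ∀ e → edgeSum (λ v → f v + g v) e ≡ edgeSum f e + edgeSum g e
    regroup e = interchange₄ (f (yR e)) (f (yL e)) (f (tv e)) (f (ze e))
                             (g (yR e)) (g (yL e)) (g (tv e)) (g (ze e))
    edges : Σedges (λ v → f v + g v) ≡ Σedges f + Σedges g
    edges = trans (total-cong (λ i → trans (total-cong (λ j → regroup (i , j)))
                                           (total-+ (λ j → edgeSum f (i , j)) (λ j → edgeSum g (i , j)))))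
                  (total-+ (λ i → total (λ j → edgeSum f (i , j))) (λ i → total (λ j → edgeSum g (i , j))))

  edgeSum≤∑Var : ∀ f e → edgeSum f e ≤ ∑Var f
  edgeSum≤∑Var f (i , j) = ≤-trans (term≤total (λ j → edgeSum f (i , j)) j)
                                   (≤-trans (term≤total (λ i → total (λ j → edgeSum f (i , j))) i) (m≤n+m _ _))

  slot≤∑Var : ∀ f v → f v ≤ ∑Var f
  slot≤∑Var f (zv k) = ≤-trans (term≤total (λ k → f (zv k)) k) (m≤m+n _ _)
  slot≤∑Var f (yR e) = ≤-trans (m+n≤o⇒m≤o _ (m+n≤o⇒m≤o _ (m+n≤o⇒m≤o _ ≤-refl))) (edgeSum≤∑Var f e)
  slot≤∑Var f (yL e) = ≤-trans (m+n≤o⇒n≤o (f (yR e)) (m+n≤o⇒m≤o _ (m+n≤o⇒m≤o _ ≤-refl))) (edgeSum≤∑Var f e)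
  slot≤∑Var f (tv e) = ≤-trans (m+n≤o⇒n≤o (f (yR e) + f (yL e)) (m+n≤o⇒m≤o _ ≤-refl)) (edgeSum≤∑Var f e)
  slot≤∑Var f (ze e) = ≤-trans (m+n≤o⇒n≤o _ ≤-refl) (edgeSum≤∑Var f e)

  length≤∑Var-mem : ∀ xs → length xs ≤ ∑Var (mem a xs)
  length≤∑Var-mem []       = z≤n
  length≤∑Var-mem (x ∷ xs) =
    subst (suc (length xs) ≤_) (sym (∑Var-+ occurs (mem a xs)))
          (+-mono-≤ (subst (_≤ ∑Var occurs) occurs-self (slot≤∑Var occurs x)) (length≤∑Var-mem xs))
    where
    occurs : Var a → ℕ
    occurs v = if does (_≟V_ a x v) then 1 else 0
    occurs-self : occurs x ≡ 1
    occurs-self = cong (λ b → if b then 1 else 0) (dec-true (_≟V_ a x x) refl)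

isFirst : ∀ {k} → Fin k → Bool
isFirst zero    = true
isFirst (suc _) = false

yDir-src : ∀ {n} {a : Fin n → ℕ} (e : Edge a) → yDir a e (src a e) ≡ yR e
yDir-src e with proj₁ e ≟ᶠ proj₁ e
... | yes _   = refl
... | no  i≢i = contradiction refl i≢i

yDir-tgt : ∀ {m} {a : Fin (suc (suc m)) → ℕ} (e : Edge a) → yDir a e (tgt a e) ≡ yL e
yDir-tgt e with sucMod (proj₁ e) ≟ᶠ proj₁ e
... | yes tgt≡src = contradiction tgt≡src (sucMod≢id (s<s z<s) (proj₁ e))
... | no  _       = refl

module Multiplicity {n} {a : Fin n → ℕ} {S : List (Var a)} (unique : Unique S) where

  open Count (_≟V_ a)

  mem≤1 : ∀ v → mem a S v ≤ 1
  mem≤1 v = count-≤1 unique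

  mem-∈ : ∀ {v} → v ∈ S → mem a S v ≡ 1
  mem-∈ v∈ = ≤-antisym (mem≤1 _) (count-∈ v∈)

  mem-∉ : ∀ {v} → v ∉ S → mem a S v ≡ 0
  mem-∉ = count-∉

  ∈-of-mem : ∀ {v} → mem a S v ≡ 1 → v ∈ S
  ∈-of-mem mem≡1 = ∈-of-count (1+n≢0 ∘ trans (sym mem≡1))

  mem-exclusive : ∀ {u v} → (u ∈ S → v ∉ S) → mem a S u + mem a S v ≤ 1
  mem-exclusive excl = exclusive-≤1 (mem≤1 _) (mem≤1 _) (λ u≡1 v≡1 → excl (∈-of-mem u≡1) (∈-of-mem v≡1))

  both : Var a → Var a → ℕ
  both u v = mem a S u * mem a S v

  both≤1 : ∀ u v → both u v ≤ 1
  both≤1 u v = *-mono-≤ (mem≤1 u) (mem≤1 v)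

  both≡1 : ∀ {u v} → u ∈ S → v ∈ S → both u v ≡ 1
  both≡1 u∈ v∈ = cong₂ _*_ (mem-∈ u∈) (mem-∈ v∈)

  both-∈ : ∀ {u v} → both u v ≢ 0 → u ∈ S × v ∈ S
  both-∈ {u} {v} both≢0 =
    ∈-of-count (λ u≡0 → both≢0 (cong (_* mem a S v) u≡0)) ,
    ∈-of-count (λ v≡0 → both≢0 (trans (cong (mem a S u *_) v≡0) (*-zeroʳ (mem a S u))))

  both≡0 : ∀ {u v} → ¬ (u ∈ S × v ∈ S) → both u v ≡ 0
  both≡0 {u} {v} ¬both with both u v ≟ 0
  ... | yes both≡0 = both≡0
  ... | no  both≢0 = contradiction (both-∈ both≢0) ¬both

module Facet {m : ℕ} {a : Fin (suc (suc m)) → ℕ} {S : List (Var a)} (facet : IsFacet a S) where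

  open Order a
  open VarSum a
  open Multiplicity (proj₁ facet)
  open DecMembership (_≟V_ a) using (_∈?_)

  RZ LZ Heavy : Edge a → Set
  RZ e    = yR e ∈ S × ze e ∈ S
  LZ e    = yL e ∈ S × ze e ∈ S
  Heavy e = RZ e ⊎ LZ e

  heavy? : ∀ e → Dec (Heavy e)
  heavy? e = ((yR e ∈? S) ×-dec (ze e ∈? S)) ⊎-dec ((yL e ∈? S) ×-dec (ze e ∈? S))

  lead-∉ : ∀ {m₁ m₂ v} → InB a m₁ m₂ → v ∈ m₁ → All (λ w → w ≡ v ⊎ Above v w) m₁ → All (Above v) m₂ →
           ¬ Contains a S m₁
  lead-∉ b v∈ below₁ below₂ m₁⊆S = proj₂ (proj₂ facet) _ _ b
    (inj₁ (>lex-from-top v∈ (All.map (Sum.map₂ above⇒≻) below₁) (All.map above⇒≻ below₂) , m₁⊆S))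

  quadratic-lead-∉ : ∀ {v u w w′} → InB a (v ∷ u ∷ []) (w ∷ w′ ∷ []) →
                     tier v < tier u → tier v < tier w → tier v < tier w′ → v ∈ S → u ∉ S
  quadratic-lead-∉ b v≻u v≻w v≻w′ v∈ u∈ =
    lead-∉ b (here refl) (inj₁ refl ∷ inj₂ (inj₁ v≻u) ∷ []) (inj₁ v≻w ∷ inj₁ v≻w′ ∷ []) (v∈ ∷ u∈ ∷ [])

  yR∈⇒yL∉ : ∀ e → yR e ∈ S → yL e ∉ S
  yR∈⇒yL∉ e = quadratic-lead-∉ (inj₁ (f1 e)) z<s z<s z<s

  yR∈⇒tv∉ : ∀ e → yR e ∈ S → tv e ∉ S
  yR∈⇒tv∉ e = quadratic-lead-∉ (inj₁ (f2 e)) z<s z<s z<s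

  yL∈⇒tv∉ : ∀ e → yL e ∈ S → tv e ∉ S
  yL∈⇒tv∉ e = quadratic-lead-∉ (inj₁ (f3 e)) (s<s z<s) (s<s z<s) (s<s z<s)

  yR∈⇒z-tgt∉ : ∀ e → yR e ∈ S → zv (tgt a e) ∉ S
  yR∈⇒z-tgt∉ e = quadratic-lead-∉ (inj₁ (f4 e)) z<s z<s z<s

  yL∈⇒z-src∉ : ∀ e → yL e ∈ S → zv (src a e) ∉ S
  yL∈⇒z-src∉ e = quadratic-lead-∉ (inj₁ (f5 e)) (s<s z<s) (s<s z<s) (s<s z<s)

  ze∈⇒tv∉ : ∀ e → ze e ∈ S → tv e ∉ S
  ze∈⇒tv∉ e ze∈ tv∈ = lead-∉ (inj₁ (f6 e)) (there (here refl))
    (inj₂ (inj₁ (s<s (s<s z<s))) ∷ inj₁ refl ∷ []) (inj₁ (s<s (s<s z<s)) ∷ inj₁ (s<s (s<s z<s)) ∷ [])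
    (tv∈ ∷ ze∈ ∷ [])

  twoCycle : ∀ i {j k : Fin (a i)} → j ≢ k → Cycle a 0
  twoCycle i {j} {k} j≢k = record
    { vert = vert ; edge = edge ; vertInj = vertInj ; edgeInj = edgeInj ; joins = joins }
    where
    vert : Fin 2 → Fin (suc (suc m))
    vert zero       = i
    vert (suc zero) = sucMod i
    edge : Fin 2 → Edge a
    edge zero       = i , j
    edge (suc zero) = i , k
    vertInj : ∀ {x y} → vert x ≡ vert y → x ≡ y
    vertInj {zero}     {zero}     _  = refl
    vertInj {zero}     {suc zero} eq = contradiction (sym eq) (sucMod≢id (s<s z<s) i)
    vertInj {suc zero} {zero}     eq = contradiction eq (sucMod≢id (s<s z<s) i)
    vertInj {suc zero} {suc zero} _  = refl
    edgeInj : ∀ {x y} → edge x ≡ edge y → x ≡ y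
    edgeInj {zero}     {zero}     _    = refl
    edgeInj {zero}     {suc zero} refl = contradiction refl j≢k
    edgeInj {suc zero} {zero}     refl = contradiction refl j≢k
    edgeInj {suc zero} {suc zero} _    = refl
    joins : ∀ t → Joins a (edge t) (vert t) (vert (sucMod t))
    joins zero       = inj₁ (refl , refl)
    joins (suc zero) = inj₂ (refl , refl)

  parallel-yR∈⇒yL∉ : ∀ {i} {j k : Fin (a i)} → j ≢ k → yR (i , j) ∈ S → yL (i , k) ∉ S
  parallel-yR∈⇒yL∉ {i} {j} {k} j≢k = quadratic-lead-∉ binomial z<s z<s z<s
    where
    binomial : InB a (yR (i , j) ∷ yL (i , k) ∷ []) (ze (i , j) ∷ ze (i , k) ∷ [])
    binomial = subst₂ (InB a) (cong₂ (λ x y → x ∷ y ∷ []) (yDir-src (i , j)) (yDir-tgt (i , k))) refl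
                      (inj₂ (inj₂ (cyc (twoCycle i j≢k) (λ _ → true))))

  parallel-yR∈⇒ze∉ : ∀ {i} {j k : Fin (a i)} → j <ᶠ k → yR (i , j) ∈ S → ze (i , k) ∉ S
  parallel-yR∈⇒ze∉ {i} {j} {k} j<k yR∈ ze∈ =
    lead-∉ binomial (here refl) (inj₁ refl ∷ inj₂ (inj₁ z<s) ∷ []) (inj₁ z<s ∷ inj₂ (idx-mono i j<k) ∷ [])
           (yR∈ ∷ ze∈ ∷ [])
    where
    binomial : InB a (yR (i , j) ∷ ze (i , k) ∷ []) (ze (i , j) ∷ yR (i , k) ∷ [])
    binomial = subst₂ (InB a) (cong (λ x → x ∷ ze (i , k) ∷ []) (yDir-src (i , j)))
                              (cong (λ x → ze (i , j) ∷ x ∷ []) (yDir-src (i , k)))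
                      (inj₂ (inj₂ (cyc (twoCycle i (<ᶠ⇒≢ j<k)) isFirst)))

  parallel-yL∈⇒ze∉ : ∀ {i} {j k : Fin (a i)} → j <ᶠ k → yL (i , k) ∈ S → ze (i , j) ∉ S
  parallel-yL∈⇒ze∉ {i} {j} {k} j<k yL∈ ze∈ =
    lead-∉ binomial (there (here refl)) (inj₂ (inj₁ (s<s z<s)) ∷ inj₁ refl ∷ [])
           (inj₂ (yL-≻ (i , k) (i , j) (idx-mono i j<k)) ∷ inj₁ (s<s z<s) ∷ []) (ze∈ ∷ yL∈ ∷ [])
    where
    binomial : InB a (ze (i , j) ∷ yL (i , k) ∷ []) (yL (i , j) ∷ ze (i , k) ∷ [])
    binomial = subst₂ (InB a) (cong (λ x → ze (i , j) ∷ x ∷ []) (yDir-tgt (i , k)))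
                              (cong (λ x → x ∷ ze (i , k) ∷ []) (yDir-tgt (i , j)))
                      (inj₂ (inj₂ (cyc (twoCycle i (<ᶠ⇒≢ j<k)) (not ∘ isFirst))))

  heavy-distinct : ∀ {i} {j k : Fin (a i)} → j <ᶠ k → Heavy (i , j) → Heavy (i , k) → ⊥
  heavy-distinct j<k (inj₁ (yRⱼ , _)) (inj₁ (_ , zeₖ))  = parallel-yR∈⇒ze∉ j<k yRⱼ zeₖ
  heavy-distinct j<k (inj₁ (yRⱼ , _)) (inj₂ (yLₖ , _))  = parallel-yR∈⇒yL∉ (<ᶠ⇒≢ j<k) yRⱼ yLₖ
  heavy-distinct j<k (inj₂ (yLⱼ , _)) (inj₁ (yRₖ , _))  = parallel-yR∈⇒yL∉ (<ᶠ⇒≢ j<k ∘ sym) yRₖ yLⱼ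
  heavy-distinct j<k (inj₂ (_ , zeⱼ)) (inj₂ (yLₖ , _))  = parallel-yL∈⇒ze∉ j<k yLₖ zeⱼ

  heavy-unique : ∀ {i} {j k : Fin (a i)} → Heavy (i , j) → Heavy (i , k) → j ≡ k
  heavy-unique {j = j} {k} hⱼ hₖ with <ᶠ-cmp j k
  ... | tri< j<k _   _   = ⊥-elim (heavy-distinct j<k hⱼ hₖ)
  ... | tri≈ _   j≡k _   = j≡k
  ... | tri> _   _   k<j = ⊥-elim (heavy-distinct k<j hₖ hⱼ)

  -- An RZ edge from vertex s to s + 1 followed by k LZ edges, going clockwise; these edges, with z_e in place
  -- of y← on all but the first one, form the leading monomial of a zig-zag or cyclic binomial.
  Run : ℕ → ℕ → Set
  Run s k = Σ (Fin (a (wrap s))) (λ j → RZ (wrap s , j))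
          × (∀ u → u < k → Σ (Fin (a (wrap (suc u + s)))) (λ j → LZ (wrap (suc u + s) , j)))

  module Walk (s k : ℕ) (run : Run s k) where

    choice : (t : Fin (suc k)) → Fin (a (wrap (toℕ t + s)))
    choice zero    = proj₁ (proj₁ run)
    choice (suc u) = proj₁ (proj₂ run (toℕ u) (toℕ<n u))

    edge : Fin (suc k) → Edge a
    edge t = wrap (toℕ t + s) , choice t

    e₀ : Edge a
    e₀ = edge zero

    yR₀∈ : yR e₀ ∈ S
    yR₀∈ = proj₁ (proj₂ (proj₁ run))

    ze∈ : ∀ u → ze (edge (suc u)) ∈ S
    ze∈ u = proj₂ (proj₂ (proj₂ run (toℕ u) (toℕ<n u)))

  run-then-z∉ : ∀ s k → suc (suc k) < suc (suc m) → Run s (suc k) → zv (wrap (suc (suc k) + s)) ∉ S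
  run-then-z∉ s k k+2<n run z∈ =
    lead-∉ (inj₂ (inj₁ (zz path isFirst refl refl))) (there (here (sym (yDir-src e₀)))) below₁ below₂ contained
    where
    open Walk s (suc k) run
    vert : Fin (suc (suc (suc k))) → Fin (suc (suc m))
    vert t = wrap (toℕ t + s)
    vertInj : ∀ {x y} → vert x ≡ vert y → x ≡ y
    vertInj {x} {y} = toℕ-injective ∘ wrap-injective s (<-≤-trans (toℕ<n x) k+2<n) (<-≤-trans (toℕ<n y) k+2<n)
    path : Path a k
    path = record
      { vert = vert ; edge = edge ; vertInj = vertInj
      ; joins = λ t → inj₁ (cong (λ x → wrap (x + s)) (toℕ-inject₁ t) , refl) }
    left right : Fin (suc (suc k)) → List (Var a)
    left t  = if isFirst t then [ yDir a (edge t) (vert (inject₁ t)) ] else [ ze (edge t) ]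
    right t = if isFirst t then [ ze (edge t) ] else [ yDir a (edge t) (vert (suc t)) ]
    below₁ : All (λ w → w ≡ yR e₀ ⊎ Above (yR e₀) w) (zigzagL a path isFirst)
    below₁ = inj₂ (inj₁ z<s) ∷ allFin-concatMap⁺ left λ where
      zero    → inj₁ (yDir-src e₀) ∷ []
      (suc _) → inj₂ (inj₁ z<s) ∷ []
    below₂ : All (Above (yR e₀)) (zigzagR a path isFirst)
    below₂ = inj₁ z<s ∷ allFin-concatMap⁺ right λ where
      zero    → inj₁ z<s ∷ []
      (suc u) → subst (Above (yR e₀)) (sym (yDir-tgt (edge (suc u)))) (inj₁ z<s) ∷ []
    contained : Contains a S (zigzagL a path isFirst)
    contained = subst (λ t → zv (wrap (t + s)) ∈ S) (sym (toℕ-fromℕ (suc (suc k)))) z∈ ∷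
                allFin-concatMap⁺ left λ where
                  zero    → subst (_∈ S) (sym (yDir-src e₀)) yR₀∈ ∷ []
                  (suc u) → ze∈ u ∷ []

  no-run-around : ∀ s → ¬ Run s (suc m)
  no-run-around s run =
    lead-∉ (inj₂ (inj₂ (cyc cycle isFirst))) (here (sym (yDir-src e₀))) below₁ below₂ contained
    where
    open Walk s (suc m) run
    vert : Fin (suc (suc m)) → Fin (suc (suc m))
    vert t = wrap (toℕ t + s)
    vertInj : ∀ {x y} → vert x ≡ vert y → x ≡ y
    vertInj {x} {y} = toℕ-injective ∘ wrap-injective s (toℕ<n x) (toℕ<n y)
    yDir-around : ∀ u → yDir a (edge (suc u)) (vert (sucMod (suc u))) ≡ yL (edge (suc u))
    yDir-around u = trans (cong (yDir a (edge (suc u))) (wrap-sucMod s (suc u))) (yDir-tgt (edge (suc u)))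
    cycle : Cycle a m
    cycle = record
      { vert = vert ; edge = edge ; vertInj = vertInj ; edgeInj = vertInj ∘ cong proj₁
      ; joins = λ t → inj₁ (refl , wrap-sucMod s t) }
    left right : Fin (suc (suc m)) → List (Var a)
    left t  = if isFirst t then [ yDir a (edge t) (vert t) ] else [ ze (edge t) ]
    right t = if isFirst t then [ ze (edge t) ] else [ yDir a (edge t) (vert (sucMod t)) ]
    below₁ : All (λ w → w ≡ yR e₀ ⊎ Above (yR e₀) w) (cycL a cycle isFirst)
    below₁ = allFin-concatMap⁺ left λ where
      zero    → inj₁ (yDir-src e₀) ∷ []
      (suc _) → inj₂ (inj₁ z<s) ∷ []
    below₂ : All (Above (yR e₀)) (cycR a cycle isFirst)
    below₂ = allFin-concatMap⁺ right λ where
      zero    → inj₁ z<s ∷ []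
      (suc u) → subst (Above (yR e₀)) (sym (yDir-around u)) (inj₁ z<s) ∷ []
    contained : Contains a S (cycL a cycle isFirst)
    contained = allFin-concatMap⁺ left λ where
      zero    → subst (_∈ S) (sym (yDir-src e₀)) yR₀∈ ∷ []
      (suc u) → ze∈ u ∷ []

  χRZ χLZ excess : Edge a → ℕ
  χRZ e    = both (yR e) (ze e)
  χLZ e    = both (yL e) (ze e)
  excess e = χRZ e + χLZ e

  nRZ nLZ χz : Fin (suc (suc m)) → ℕ
  nRZ i = total (λ j → χRZ (i , j))
  nLZ i = total (λ j → χLZ (i , j))
  χz k  = mem a S (zv k)

  excess≤1 : ∀ e → excess e ≤ 1
  excess≤1 e = exclusive-≤1 (both≤1 _ _) (both≤1 _ _) (λ χRZ≡1 χLZ≡1 →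
    yR∈⇒yL∉ e (proj₁ (both-∈ (1+n≢0 ∘ trans (sym χRZ≡1)))) (proj₁ (both-∈ (1+n≢0 ∘ trans (sym χLZ≡1)))))

  excess≡1⇒heavy : ∀ e → excess e ≡ 1 → Heavy e
  excess≡1⇒heavy e excess≡1 with χRZ e ≟ 0
  ... | no  χRZ≢0 = inj₁ (both-∈ χRZ≢0)
  ... | yes χRZ≡0 = inj₂ (both-∈ (λ χLZ≡0 → 1+n≢0 (trans (sym excess≡1) (cong₂ _+_ χRZ≡0 χLZ≡0))))

  nRZ+nLZ≤1 : ∀ i → nRZ i + nLZ i ≤ 1
  nRZ+nLZ≤1 i = subst (_≤ 1) (total-+ (λ j → χRZ (i , j)) (λ j → χLZ (i , j)))
    (total-≤1 (λ j → excess (i , j)) (λ j → excess≤1 (i , j))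
              (λ j k excessⱼ≡1 excessₖ≡1 →
                 heavy-unique (excess≡1⇒heavy _ excessⱼ≡1) (excess≡1⇒heavy _ excessₖ≡1)))

  nonzero-term : ∀ {i} (f : Fin (a i) → ℕ) → total f ≡ 1 → ∃ λ j → f j ≢ 0
  nonzero-term f Σf≡1 = total-nonzero f (1+n≢0 ∘ trans (sym Σf≡1))

  χz+nLZ≤1 : ∀ i → χz i + nLZ i ≤ 1
  χz+nLZ≤1 i = exclusive-≤1 (mem≤1 _) (m+n≤o⇒n≤o (nRZ i) (nRZ+nLZ≤1 i)) (λ χz≡1 nLZ≡1 →
    let (j , χLZ≢0) = nonzero-term (λ j → χLZ (i , j)) nLZ≡1
    in  yL∈⇒z-src∉ (i , j) (proj₁ (both-∈ χLZ≢0)) (∈-of-mem χz≡1))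

  run-of : ∀ s k → nRZ (wrap s) ≡ 1 → (∀ u → u < k → nLZ (wrap (suc u + s)) ≡ 1) → Run s k
  run-of s k nRZ≡1 nLZ≡1 =
    (let (j , χRZ≢0) = nonzero-term (λ j → χRZ (wrap s , j)) nRZ≡1 in j , both-∈ χRZ≢0) ,
    (λ u u<k → let (j , χLZ≢0) = nonzero-term (λ j → χLZ (wrap (suc u + s) , j)) (nLZ≡1 u u<k)
               in  j , both-∈ χLZ≢0)

  no-run : ∀ s k → k < suc (suc m) → nRZ (wrap s) ≡ 1 → (∀ u → u < k → nLZ (wrap (suc u + s)) ≡ 1) →
           χz (wrap (suc k + s)) ≡ 1 → ⊥
  no-run s zero _ nRZ≡1 nLZ≡1 χz≡1 =
    let ((j , yR∈ , _) , _) = run-of s 0 nRZ≡1 nLZ≡1 in yR∈⇒z-tgt∉ (wrap s , j) yR∈ (∈-of-mem χz≡1)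
  no-run s (suc k) k<n nRZ≡1 nLZ≡1 χz≡1 with m≤n⇒m<n∨m≡n k<n
  ... | inj₁ k+2<n = run-then-z∉ s k k+2<n (run-of s (suc k) nRZ≡1 nLZ≡1) (∈-of-mem χz≡1)
  ... | inj₂ refl  = no-run-around s (run-of s (suc m) nRZ≡1 nLZ≡1)

  card≤1+excess : ∀ e → cardV a S e ≤ 1 + excess e
  card≤1+excess e with ze e ∈? S
  ... | no ze∉ = begin
    x + y + t + mem a S (ze e)  ≡⟨ trans (cong (x + y + t +_) (mem-∉ ze∉)) (+-identityʳ _) ⟩
    x + y + t                   ≤⟨ pairwise-≤1 {x} {y} {t} (mem-exclusive (yR∈⇒yL∉ e))
                                     (mem-exclusive (yR∈⇒tv∉ e)) (mem-exclusive (yL∈⇒tv∉ e)) ⟩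
    1                           ≤⟨ m≤m+n 1 _ ⟩
    1 + excess e                ∎
    where
    open ≤-Reasoning
    x = mem a S (yR e)
    y = mem a S (yL e)
    t = mem a S (tv e)
  ... | yes ze∈ = ≤-reflexive (begin
    x + y + t + mem a S (ze e)  ≡⟨ cong₂ (λ t z → x + y + t + z) (mem-∉ (ze∈⇒tv∉ e ze∈)) (mem-∈ ze∈) ⟩
    x + y + 0 + 1               ≡⟨ trans (+-comm _ 1) (cong suc (+-identityʳ (x + y))) ⟩
    1 + (x + y)                 ≡⟨ cong₂ (λ p q → 1 + (p + q)) (*-identityʳ x) (*-identityʳ y) ⟨
    1 + (x * 1 + y * 1)         ≡⟨ cong (λ z → 1 + (x * z + y * z)) (mem-∈ ze∈) ⟨
    1 + excess e                ∎)
    where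
    open ≡-Reasoning
    x = mem a S (yR e)
    y = mem a S (yL e)
    t = mem a S (tv e)

  cardV-exact : ∀ e → cardV a S e ≡ 1 + excess e
  cardV-exact (i , j) =
    total-tight⇒pointwise-≡ (λ j → card≤1+excess (i , j)) (≤-reflexive (sym (total-tight⇒pointwise-≡ card≤bound counted i))) j
    where
    open ≤-Reasoning
    open +-*-Solver
    bound actual : Fin (suc (suc m)) → ℕ
    bound  i = total (λ j → 1 + excess (i , j))
    actual i = total (λ j → cardV a S (i , j))
    card≤bound : ∀ i → actual i ≤ bound i
    card≤bound i = total-mono-≤ (λ j → card≤1+excess (i , j))
    bound≡ : ∀ i → bound i ≡ a i + (nRZ i + nLZ i)
    bound≡ i = trans (total-+ (λ _ → 1) (λ j → excess (i , j)))
                     (cong₂ _+_ (trans (total-const (a i) 1) (*-identityʳ (a i)))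
                                (total-+ (λ j → χRZ (i , j)) (λ j → χLZ (i , j))))
    counted : total bound ≤ total actual
    counted = +-cancelˡ-≤ (total χz) _ _ (begin
      total χz + total bound
        ≡⟨ cong (total χz +_) (trans (total-cong bound≡) (trans (total-+ a (λ i → nRZ i + nLZ i))
                                                                (cong (total a +_) (total-+ nRZ nLZ)))) ⟩
      total χz + (total a + (total nRZ + total nLZ))
        ≡⟨ solve 4 (λ z t r l → z :+ (t :+ (r :+ l)) := r :+ z :+ l :+ t) refl
                 (total χz) (total a) (total nRZ) (total nLZ) ⟩
      total nRZ + total χz + total nLZ + total a
        ≤⟨ +-monoˡ-≤ (total a) (ArrowsAndMarks.arrows+marks≤n nRZ χz nLZ nRZ+nLZ≤1 χz+nLZ≤1 no-run) ⟩
      suc (suc m) + total a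
        ≡⟨ proj₁ (proj₂ facet) ⟨
      length S
        ≤⟨ length≤∑Var-mem S ⟩
      total χz + total actual ∎)

  light⇒card≡1 : ∀ {e} → ¬ RZ e → ¬ LZ e → cardV a S e ≡ 1
  light⇒card≡1 {e} ¬RZ ¬LZ = trans (cardV-exact e) (cong₂ (λ p q → 1 + (p + q)) (both≡0 ¬RZ) (both≡0 ¬LZ))

  heavy⇒card≢1 : ∀ {e} → Heavy e → cardV a S e ≢ 1
  heavy⇒card≢1 {e} heavy card≡1 = 1+n≢0 (one≡0 heavy)
    where
    excess≡0 : excess e ≡ 0
    excess≡0 = suc-injective (trans (sym (cardV-exact e)) card≡1)
    one≡0 : Heavy e → 1 ≡ 0
    one≡0 (inj₁ (yR∈ , ze∈)) = trans (sym (both≡1 yR∈ ze∈)) (m+n≡0⇒m≡0 (χRZ e) excess≡0)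
    one≡0 (inj₂ (yL∈ , ze∈)) = trans (sym (both≡1 yL∈ ze∈)) (m+n≡0⇒n≡0 (χRZ e) excess≡0)

  infix 4 _∈V_
  _∈V_ : Var a → Edge a → Set
  v ∈V e = v ≡ yR e ⊎ v ≡ yL e ⊎ v ≡ tv e ⊎ v ≡ ze e

  only-tv-ze : ∀ {e} → yR e ∉ S → yL e ∉ S → ∀ v → v ∈ S → v ∈V e → v ≡ tv e ⊎ v ≡ ze e
  only-tv-ze yR∉ _   _ v∈ (inj₁ refl)                = contradiction v∈ yR∉
  only-tv-ze _   yL∉ _ v∈ (inj₂ (inj₁ refl))         = contradiction v∈ yL∉
  only-tv-ze _   _   _ _  (inj₂ (inj₂ (inj₁ v≡tv))) = inj₁ v≡tv
  only-tv-ze _   _   _ _  (inj₂ (inj₂ (inj₂ v≡ze))) = inj₂ v≡ze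

  only-tv-yR : ∀ {e} → yL e ∉ S → ze e ∉ S → ∀ v → v ∈ S → v ∈V e → v ≡ tv e ⊎ v ≡ yR e
  only-tv-yR _   _   _ _  (inj₁ v≡yR)                = inj₂ v≡yR
  only-tv-yR yL∉ _   _ v∈ (inj₂ (inj₁ refl))         = contradiction v∈ yL∉
  only-tv-yR _   _   _ _  (inj₂ (inj₂ (inj₁ v≡tv))) = inj₁ v≡tv
  only-tv-yR _   ze∉ _ v∈ (inj₂ (inj₂ (inj₂ refl))) = contradiction v∈ ze∉

  only-tv-yL : ∀ {e} → yR e ∉ S → ze e ∉ S → ∀ v → v ∈ S → v ∈V e → v ≡ tv e ⊎ v ≡ yL e
  only-tv-yL yR∉ _   _ v∈ (inj₁ refl)                = contradiction v∈ yR∉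
  only-tv-yL _   _   _ _  (inj₂ (inj₁ v≡yL))         = inj₂ v≡yL
  only-tv-yL _   _   _ _  (inj₂ (inj₂ (inj₁ v≡tv))) = inj₁ v≡tv
  only-tv-yL _   ze∉ _ v∈ (inj₂ (inj₂ (inj₂ refl))) = contradiction v∈ ze∉

  others-light : ∀ {i} {j k : Fin (a i)} → Heavy (i , j) → k ≢ j → cardV a S (i , k) ≡ 1
  others-light hⱼ k≢j =
    light⇒card≡1 (λ rz → k≢j (heavy-unique (inj₁ rz) hⱼ)) (λ lz → k≢j (heavy-unique (inj₂ lz) hⱼ))

  caseA : ∀ {i j} → RZ (i , j) → CaseA a S i
  caseA {i} {j} rz@(yR∈ , ze∈) =
    j , (yR∈ , ze∈ , yR∈⇒yL∉ _ yR∈ , yR∈⇒tv∉ _ yR∈) ,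
    (λ j′ (yR∈′ , ze∈′ , _) → heavy-unique (inj₁ (yR∈′ , ze∈′)) (inj₁ rz)) ,
    λ k k≢j →
      (λ k<j → others-light (inj₁ rz) k≢j ,
               only-tv-ze (λ yRₖ∈ → parallel-yR∈⇒ze∉ k<j yRₖ∈ ze∈) (parallel-yR∈⇒yL∉ (k≢j ∘ sym) yR∈)) ,
      (λ j<k → others-light (inj₁ rz) k≢j ,
               only-tv-yR (parallel-yR∈⇒yL∉ (k≢j ∘ sym) yR∈) (parallel-yR∈⇒ze∉ j<k yR∈))

  caseB : ∀ {i j} → LZ (i , j) → CaseB a S i
  caseB {i} {j} lz@(yL∈ , ze∈) =
    j , (yL∈ , ze∈ , (λ yR∈ → yR∈⇒yL∉ _ yR∈ yL∈) , yL∈⇒tv∉ _ yL∈) ,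
    (λ j′ (yL∈′ , ze∈′ , _) → heavy-unique (inj₂ (yL∈′ , ze∈′)) (inj₂ lz)) ,
    λ k k≢j →
      (λ k<j → others-light (inj₂ lz) k≢j ,
               only-tv-yL (λ yRₖ∈ → parallel-yR∈⇒yL∉ k≢j yRₖ∈ yL∈) (parallel-yL∈⇒ze∉ k<j yL∈)) ,
      (λ j<k → others-light (inj₂ lz) k≢j ,
               only-tv-ze (λ yRₖ∈ → parallel-yR∈⇒yL∉ k≢j yRₖ∈ yL∈) (λ yLₖ∈ → parallel-yL∈⇒ze∉ j<k yLₖ∈ ze∈))

  caseC : ∀ {i} → ¬ (∃ λ j → Heavy (i , j)) → CaseC a S i
  caseC none j = light⇒card≡1 (λ rz → none (j , inj₁ rz)) (λ lz → none (j , inj₂ lz))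

  A⇒heavy : ∀ {i} → CaseA a S i → ∃ λ j → Heavy (i , j)
  A⇒heavy (j , (yR∈ , ze∈ , _) , _) = j , inj₁ (yR∈ , ze∈)

  B⇒heavy : ∀ {i} → CaseB a S i → ∃ λ j → Heavy (i , j)
  B⇒heavy (j , (yL∈ , ze∈ , _) , _) = j , inj₂ (yL∈ , ze∈)

  heavy⇒¬C : ∀ {i} → (∃ λ j → Heavy (i , j)) → ¬ CaseC a S i
  heavy⇒¬C (j , h) C = heavy⇒card≢1 h (C j)

  A⇒¬B : ∀ {i} → CaseA a S i → ¬ CaseB a S i
  A⇒¬B {i} (j , (yR∈ , ze∈ , yL∉ , _) , _) (k , (yL∈ , ze∈′ , _) , _) =
    yL∉ (subst (λ x → yL (i , x) ∈ S) (heavy-unique (inj₂ (yL∈ , ze∈′)) (inj₁ (yR∈ , ze∈))) yL∈)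

lemma4p1 : (n : ℕ) (a : Fin n → ℕ) → 3 ≤ n → (∀ i → 1 ≤ a i) →
           (S : List (Var a)) → IsFacet a S → (i : Fin n) →
           ExactlyOne (CaseA a S i) (CaseB a S i) (CaseC a S i)
lemma4p1 zero          a ()       _ S facet i
lemma4p1 (suc zero)    a (s≤s ()) _ S facet i
lemma4p1 (suc (suc m)) a _        _ S facet i = classify (any? (λ j → heavy? (i , j)))
  where
  open Facet facet
  classify : Dec (∃ λ j → Heavy (i , j)) → ExactlyOne (CaseA a S i) (CaseB a S i) (CaseC a S i)
  classify (yes (j , inj₁ rz)) = inj₁ (caseA rz , A⇒¬B (caseA rz) , heavy⇒¬C (j , inj₁ rz))
  classify (yes (j , inj₂ lz)) = inj₂ (inj₁ ((λ A → A⇒¬B A (caseB lz)) , caseB lz , heavy⇒¬C (j , inj₂ lz)))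
  classify (no none)           = inj₂ (inj₂ (none ∘ A⇒heavy , none ∘ B⇒heavy , caseC none))
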